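{- Let $m \ge 0$ be an integer, let $k = 4m+3$, and let $f(x,z) = \lfloor \frac{x+z}{k} \rfloor$ for non-negative integers $x,z$. Consider the impartial game whose positions are triples $(x,y,z)$ of non-negative integers with $y \le f(x,z)$, in which a move from $(x,y,z)$ goes to one of the following positions: (i) $(u, \min(f(u,z),y), z)$ for some integer $0 \le u < x$; (ii) $(x, v, z)$ for some integer $0 \le v < y$; (iii) $(x, \min(y, f(x,w)), w)$ for some integer $0 \le w < z$. The players alternate moves, and the player who cannot move (this happens exactly at $(0,0,0)$) loses. Then the position $(x,y,z)$ is a $\mathcal{P}$-position if and only if $x \oplus y \oplus z = 0$.
   Context: This game models the three-dimensional chocolate bar $CB(f,x,y,z)$: for $0\le u\le x$, $0\le w\le z$ the column at $(u,w)$ has height $\min(f(u,w),y)+1$, there is a bitter cube at $(0,0)$ at the bottom, players cut the bar along grooves and eat the piece without the bitter cube, and the player who leaves the opponent only the bitter cube wins; the moves above describe the resulting coordinates. $\oplus$ denotes nim-sum (bitwise XOR of binary expansions). A $\mathcal{P}$-position is a position from which the previous player (the player who just moved) can force a win. -}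

module Defs where

open import Data.Nat using (ℕ; zero; suc; _+_; _*_; _<_; _≤_; _⊓_; _/_; _%_; _≡ᵇ_)
open import Data.Bool using (Bool; true; false; _xor_; if_then_else_)
open import Data.Product using (Σ; _×_; _,_)
open import Relation.Binary.PropositionalEquality using (_≡_)

-- Bitwise XOR (nim-sum) on ℕ, with fuel; the fuel (m + n) always suffices
-- since each step halves both arguments.
xorFuel : ℕ → ℕ → ℕ → ℕ
xorFuel zero    m n = 0
xorFuel (suc f) m n =
  (if ((m % 2) ≡ᵇ (n % 2)) then 0 else 1) + 2 * xorFuel f (m / 2) (n / 2)

infixl 6 _⊕_
_⊕_ : ℕ → ℕ → ℕ
m ⊕ n = xorFuel (m + n) m n

fk : ℕ → ℕ → ℕ → ℕ
fk m x z = (x + z) / suc (suc (suc (4 * m)))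

Pos : Set
Pos = ℕ × ℕ × ℕ

Legal : ℕ → Pos → Set
Legal m (x , y , z) = y ≤ fk m x z

data Move (m : ℕ) : Pos → Pos → Set where
  moveX : ∀ {x y z} u → u < x → Move m (x , y , z) (u , (fk m u z ⊓ y) , z)
  moveY : ∀ {x y z} v → v < y → Move m (x , y , z) (x , v , z)
  moveZ : ∀ {x y z} w → w < z → Move m (x , y , z) (x , (y ⊓ fk m x w) , w)

mutual
  data IsP (m : ℕ) (p : Pos) : Set where
    isP : (∀ q → Move m p q → IsN m q) → IsP m p

  data IsN (m : ℕ) (p : Pos) : Set where
    isN : ∀ q → Move m p q → IsP m q → IsN m p

-- Write f(x, z) = ⌊(x + z)/k⌋ with k = 2c + 1 and c = 2m + 1. Bitwise, (t ⊕ o) + o = t + 2 (o ∖ t),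
-- where o ∖ t keeps the bits of o that are not in t; hence t ≤ f(t ⊕ o, o) iff c t ≤ o ∖ t.
-- A position with x ⊕ y ⊕ z = 0 has x = y ⊕ z and is legal iff c y ≤ z ∖ y.  Moves in y are nim
-- moves, and moves in z mirror moves in x.  From such a position, an x-move to u = t ⊕ z < x whose
-- y-coordinate is capped to t = f(u, z) < y is impossible: for odd c a descent over the digits gives
-- c (t + 1) < z ∖ t, i.e. f(t ⊕ z, z) > t.  Conversely, from a position with non-zero nim-sum
-- Bouton's argument provides a nim move; if it is an x-move and the cap interferes, there is a run
-- of values t < y, all with t ⊕ z < x, starting at some t with c t ≤ z ∖ t.  Since z ∖ t − c t
-- cannot jump from above c to below 0, some t in the run has f(t ⊕ z, z) = t, and the x-move to
-- t ⊕ z reaches (t ⊕ z, t, z).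

module Submission where

open import Algebra.Bundles using (AbelianGroup)
open import Algebra.Structures using (IsAbelianGroup)
open import Data.Bool using (Bool; true; false; not; _∧_; _xor_; if_then_else_)
open import Data.Bool.Properties using (xor-comm; xor-assoc; xor-same; xor-identityʳ; ∧-zeroʳ)
open import Data.Empty using (⊥; ⊥-elim)
open import Data.Nat using (ℕ; NonZero; zero; suc; _+_; _*_; _∸_; _⊓_; _≤_; _<_; z≤n; s≤s; _/_; _%_; _≡ᵇ_; _≟_; _≤?_; _<?_)
open import Data.Nat.DivMod
open import Data.Nat.Divisibility using (m∣m*n)
open import Data.Nat.Induction using (<-wellFounded)
open import Data.Nat.Properties
open import Data.Nat.Tactic.RingSolver using (solve-∀)
open import Data.Product using (Σ; ∃-syntax; _,_; _×_; proj₁; proj₂)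
open import Data.Sum using (_⊎_; inj₁; inj₂) renaming (map to ⊎-map)
open import Function.Bundles using (_⇔_; mk⇔)
open import Induction.WellFounded using (Acc; acc)
open import Level using (0ℓ)
open import Relation.Binary.PropositionalEquality
open import Relation.Nullary using (yes; no; contradiction)

open import Defs

bit : Bool → ℕ
bit false = 0
bit true  = 1

bit≤1 : ∀ i → bit i ≤ 1
bit≤1 false = z≤n
bit≤1 true  = s≤s z≤n

[bit+2*n]%2≡bit : ∀ i n → (bit i + 2 * n) % 2 ≡ bit i
[bit+2*n]%2≡bit i n = begin
  (bit i + 2 * n) % 2 ≡⟨ cong (λ r → (bit i + r) % 2) (*-comm 2 n) ⟩
  (bit i + n * 2) % 2 ≡⟨ [m+kn]%n≡m%n (bit i) n 2 ⟩
  bit i % 2           ≡⟨ m<n⇒m%n≡m (s≤s (bit≤1 i)) ⟩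
  bit i               ∎
  where open ≡-Reasoning

[bit+2*n]/2≡n : ∀ i n → (bit i + 2 * n) / 2 ≡ n
[bit+2*n]/2≡n i n = begin
  (bit i + 2 * n) / 2   ≡⟨ +-distrib-/-∣ʳ (bit i) (m∣m*n n) ⟩
  bit i / 2 + 2 * n / 2 ≡⟨ cong₂ _+_ (m<n⇒m/n≡0 (s≤s (bit≤1 i))) (cong (_/ 2) (*-comm 2 n)) ⟩
  n * 2 / 2             ≡⟨ m*n/n≡m n 2 ⟩
  n                     ∎
  where open ≡-Reasoning

binary-split : ∀ n → Σ Bool λ i → Σ ℕ λ a → n ≡ bit i + 2 * a
binary-split n with n % 2 | m≡m%n+[m/n]*n n 2 | m%n<n n 2
... | 0           | eq | _ = false , n / 2 , trans eq (*-comm (n / 2) 2)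
... | 1           | eq | _ = true , n / 2 , trans eq (cong suc (*-comm (n / 2) 2))
... | suc (suc _) | _  | s≤s (s≤s ())

n≤bit+2*n : ∀ i n → n ≤ bit i + 2 * n
n≤bit+2*n i n = ≤-trans (m≤m+n n (n + 0)) (m≤n+m (2 * n) (bit i))

m≤1+n⇒m/2≤n : ∀ {m n} → m ≤ suc n → m / 2 ≤ n
m≤1+n⇒m/2≤n {m} {n} le = ≤-pred (begin-strict
  m / 2     ≤⟨ /-monoˡ-≤ 2 le ⟩
  suc n / 2 <⟨ m/n<m (suc n) 2 (s≤s (s≤s z≤n)) ⟩
  suc n     ∎)
  where open ≤-Reasoning

bit+2*-cong : ∀ {i j a b} → i ≡ j → a ≡ b → bit i + 2 * a ≡ bit j + 2 * b
bit+2*-cong = cong₂ (λ u v → bit u + 2 * v)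

bit+2*-mono-< : ∀ i j {a b} → a < b → bit i + 2 * a < bit j + 2 * b
bit+2*-mono-< i j {a} {b} a<b = begin-strict
  bit i + 2 * a ≤⟨ +-monoˡ-≤ (2 * a) (bit≤1 i) ⟩
  1 + 2 * a     <⟨ ≤-reflexive (sym (*-suc 2 a)) ⟩
  2 * suc a     ≤⟨ *-monoʳ-≤ 2 a<b ⟩
  2 * b         ≤⟨ m≤n+m (2 * b) (bit j) ⟩
  bit j + 2 * b ∎
  where open ≤-Reasoning

bit+2*-cancel-≤ : ∀ i j {a b} → bit i + 2 * a ≤ bit j + 2 * b → a ≤ b
bit+2*-cancel-≤ i j le = ≮⇒≥ (λ b<a → <⇒≱ (bit+2*-mono-< j i b<a) le)

bit+2*-<-≤ : ∀ {i j a b} → bit i < bit j → a ≤ b → bit i + 2 * a < bit j + 2 * b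
bit+2*-<-≤ lt le = +-mono-<-≤ lt (*-monoʳ-≤ 2 le)

1+2*m≢2*n : ∀ m n → 1 + 2 * m ≢ 2 * n
1+2*m≢2*n m n eq with trans (sym ([bit+2*n]%2≡bit true m)) (trans (cong (_% 2) eq) ([bit+2*n]%2≡bit false n))
... | ()

m*[2*n]≡2*[m*n] : ∀ m n → m * (2 * n) ≡ 2 * (m * n)
m*[2*n]≡2*[m*n] = solve-∀

*-bit+2*-cancel-≤ : ∀ c i j {a b} → c * (bit i + 2 * a) ≤ bit j + 2 * b → c * a ≤ b
*-bit+2*-cancel-≤ c i j {a} {b} le = bit+2*-cancel-≤ false j (begin
  2 * (c * a)               ≤⟨ m≤n+m (2 * (c * a)) (c * bit i) ⟩
  c * bit i + 2 * (c * a)   ≡⟨ distrib c (bit i) a ⟨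
  c * (bit i + 2 * a)       ≤⟨ le ⟩
  bit j + 2 * b             ∎)
  where
  open ≤-Reasoning
  distrib : ∀ c p a → c * (p + 2 * a) ≡ c * p + 2 * (c * a)
  distrib = solve-∀

binary-ind₃ : (P : ℕ → ℕ → ℕ → Set) → P 0 0 0 →
             (∀ i j l {a b c} → P a b c → P (bit i + 2 * a) (bit j + 2 * b) (bit l + 2 * c)) →
             ∀ a b c → P a b c
binary-ind₃ P base step a b c = go (a + b + c) (≤-trans (m≤m+n a b) (m≤m+n _ c)) (≤-trans (m≤n+m b a) (m≤m+n _ c)) (m≤n+m c _)
  where
  go : ∀ f {a b c} → a ≤ f → b ≤ f → c ≤ f → P a b c
  go zero z≤n z≤n z≤n = base
  go (suc f) {a} {b} {c} a≤ b≤ c≤ with binary-split a | binary-split b | binary-split c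
  ... | i , a′ , refl | j , b′ , refl | l , c′ , refl =
    step i j l (go f (half i a′ a≤) (half j b′ b≤) (half l c′ c≤))
    where
    half : ∀ i n → bit i + 2 * n ≤ suc f → n ≤ f
    half i n le = subst (_≤ f) ([bit+2*n]/2≡n i n) (m≤1+n⇒m/2≤n le)

binary-ind₂ : (P : ℕ → ℕ → Set) → P 0 0 →
              (∀ i j {a b} → P a b → P (bit i + 2 * a) (bit j + 2 * b)) →
              ∀ a b → P a b
binary-ind₂ P base step a b = binary-ind₃ (λ a b _ → P a b) base (λ i j _ → step i j) a b 0

lsb : ℕ → Bool
lsb n = n % 2 ≡ᵇ 1

lsb-bit : ∀ i n → lsb (bit i + 2 * n) ≡ i
lsb-bit i n rewrite [bit+2*n]%2≡bit i n with i
... | false = refl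
... | true  = refl

bitwiseFuel : (Bool → Bool → Bool) → ℕ → ℕ → ℕ → ℕ
bitwiseFuel g zero    m n = 0
bitwiseFuel g (suc f) m n = bit (g (lsb m) (lsb n)) + 2 * bitwiseFuel g f (m / 2) (n / 2)

bitwise : (Bool → Bool → Bool) → ℕ → ℕ → ℕ
bitwise g m n = bitwiseFuel g (m + n) m n

module _ (g : Bool → Bool → Bool) (g-zero : g false false ≡ false) where

  bitwiseFuel-0-0 : ∀ f → bitwiseFuel g f 0 0 ≡ 0
  bitwiseFuel-0-0 zero    = refl
  bitwiseFuel-0-0 (suc f) rewrite g-zero | bitwiseFuel-0-0 f = refl

  bitwiseFuel-irrelevant : ∀ {f f' m n} → m ≤ f → n ≤ f → m ≤ f' → n ≤ f' →
                           bitwiseFuel g f m n ≡ bitwiseFuel g f' m n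
  bitwiseFuel-irrelevant {zero} {f'} z≤n z≤n _ _ = sym (bitwiseFuel-0-0 f')
  bitwiseFuel-irrelevant {suc f} {zero} _ _ z≤n z≤n = bitwiseFuel-0-0 (suc f)
  bitwiseFuel-irrelevant {suc f} {suc f'} {m} {n} m≤ n≤ m≤' n≤' =
    cong (λ r → bit (g (lsb m) (lsb n)) + 2 * r)
      (bitwiseFuel-irrelevant (m≤1+n⇒m/2≤n m≤) (m≤1+n⇒m/2≤n n≤) (m≤1+n⇒m/2≤n m≤') (m≤1+n⇒m/2≤n n≤'))

  bitwise-bit : ∀ i j a b → bitwise g (bit i + 2 * a) (bit j + 2 * b) ≡ bit (g i j) + 2 * bitwise g a b
  bitwise-bit i j a b = begin
    bitwise g x y
      ≡⟨ bitwiseFuel-irrelevant {m = x} {n = y} (m≤m+n x y) (m≤n+m y x) (m≤n⇒m≤1+n (m≤m+n x y)) (m≤n⇒m≤1+n (m≤n+m y x)) ⟩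
    bit (g (lsb x) (lsb y)) + 2 * bitwiseFuel g (x + y) (x / 2) (y / 2)
      ≡⟨ cong₂ (λ u v → bit (g u v) + 2 * bitwiseFuel g (x + y) (x / 2) (y / 2)) (lsb-bit i a) (lsb-bit j b) ⟩
    bit (g i j) + 2 * bitwiseFuel g (x + y) (x / 2) (y / 2)
      ≡⟨ cong₂ (λ u v → bit (g i j) + 2 * bitwiseFuel g (x + y) u v) ([bit+2*n]/2≡n i a) ([bit+2*n]/2≡n j b) ⟩
    bit (g i j) + 2 * bitwiseFuel g (x + y) a b
      ≡⟨ cong (λ r → bit (g i j) + 2 * r) (bitwiseFuel-irrelevant (≤-trans (n≤bit+2*n i a) (m≤m+n x y)) (≤-trans (n≤bit+2*n j b) (m≤n+m y x)) (m≤m+n a b) (m≤n+m b a)) ⟩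
    bit (g i j) + 2 * bitwise g a b
      ∎
    where
    x y : ℕ
    x = bit i + 2 * a
    y = bit j + 2 * b
    open ≡-Reasoning

xorDigit≡bit-xor : ∀ {p q} → p < 2 → q < 2 → (if p ≡ᵇ q then 0 else 1) ≡ bit ((p ≡ᵇ 1) xor (q ≡ᵇ 1))
xorDigit≡bit-xor (s≤s z≤n)       (s≤s z≤n)       = refl
xorDigit≡bit-xor (s≤s z≤n)       (s≤s (s≤s z≤n)) = refl
xorDigit≡bit-xor (s≤s (s≤s z≤n)) (s≤s z≤n)       = refl
xorDigit≡bit-xor (s≤s (s≤s z≤n)) (s≤s (s≤s z≤n)) = refl

xorFuel≡bitwiseFuel : ∀ f m n → xorFuel f m n ≡ bitwiseFuel _xor_ f m n
xorFuel≡bitwiseFuel zero    m n = refl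
xorFuel≡bitwiseFuel (suc f) m n =
  cong₂ (λ u v → u + 2 * v) (xorDigit≡bit-xor (m%n<n m 2) (m%n<n n 2)) (xorFuel≡bitwiseFuel f (m / 2) (n / 2))

⊕≡bitwise-xor : ∀ m n → m ⊕ n ≡ bitwise _xor_ m n
⊕≡bitwise-xor m n = xorFuel≡bitwiseFuel (m + n) m n

⊕-bit : ∀ i j a b → (bit i + 2 * a) ⊕ (bit j + 2 * b) ≡ bit (i xor j) + 2 * (a ⊕ b)
⊕-bit i j a b = begin
  (bit i + 2 * a) ⊕ (bit j + 2 * b)       ≡⟨ ⊕≡bitwise-xor (bit i + 2 * a) (bit j + 2 * b) ⟩
  bitwise _xor_ (bit i + 2 * a) (bit j + 2 * b) ≡⟨ bitwise-bit _xor_ refl i j a b ⟩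
  bit (i xor j) + 2 * bitwise _xor_ a b ≡⟨ cong (λ r → bit (i xor j) + 2 * r) (⊕≡bitwise-xor a b) ⟨
  bit (i xor j) + 2 * (a ⊕ b) ∎
  where open ≡-Reasoning

⊕-comm : ∀ a b → a ⊕ b ≡ b ⊕ a
⊕-comm = binary-ind₂ (λ a b → a ⊕ b ≡ b ⊕ a) refl
  (λ i j {a} {b} ih → trans (⊕-bit i j a b) (trans (bit+2*-cong (xor-comm i j) ih) (sym (⊕-bit j i b a))))

⊕-assoc : ∀ a b c → (a ⊕ b) ⊕ c ≡ a ⊕ (b ⊕ c)
⊕-assoc = binary-ind₃ (λ a b c → (a ⊕ b) ⊕ c ≡ a ⊕ (b ⊕ c)) refl step
  where
  step : ∀ i j l {a b c} → (a ⊕ b) ⊕ c ≡ a ⊕ (b ⊕ c) →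
         ((bit i + 2 * a) ⊕ (bit j + 2 * b)) ⊕ (bit l + 2 * c) ≡ (bit i + 2 * a) ⊕ ((bit j + 2 * b) ⊕ (bit l + 2 * c))
  step i j l {a} {b} {c} ih = begin
    ((bit i + 2 * a) ⊕ (bit j + 2 * b)) ⊕ (bit l + 2 * c) ≡⟨ cong (_⊕ (bit l + 2 * c)) (⊕-bit i j a b) ⟩
    (bit (i xor j) + 2 * (a ⊕ b)) ⊕ (bit l + 2 * c)       ≡⟨ ⊕-bit (i xor j) l (a ⊕ b) c ⟩
    bit ((i xor j) xor l) + 2 * ((a ⊕ b) ⊕ c)             ≡⟨ bit+2*-cong (xor-assoc i j l) ih ⟩
    bit (i xor (j xor l)) + 2 * (a ⊕ (b ⊕ c))             ≡⟨ ⊕-bit i (j xor l) a (b ⊕ c) ⟨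
    (bit i + 2 * a) ⊕ (bit (j xor l) + 2 * (b ⊕ c))       ≡⟨ cong ((bit i + 2 * a) ⊕_) (⊕-bit j l b c) ⟨
    (bit i + 2 * a) ⊕ ((bit j + 2 * b) ⊕ (bit l + 2 * c)) ∎
    where open ≡-Reasoning

⊕-identityʳ : ∀ a → a ⊕ 0 ≡ a
⊕-identityʳ a = binary-ind₂ (λ a _ → a ⊕ 0 ≡ a) refl
  (λ i _ {a} ih → trans (⊕-bit i false a 0) (bit+2*-cong (xor-identityʳ i) ih))
  a 0

⊕-identityˡ : ∀ a → 0 ⊕ a ≡ a
⊕-identityˡ a = trans (⊕-comm 0 a) (⊕-identityʳ a)

⊕-self : ∀ a → a ⊕ a ≡ 0
⊕-self a = binary-ind₂ (λ a _ → a ⊕ a ≡ 0) refl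
  (λ i _ {a} ih → trans (⊕-bit i i a a) (bit+2*-cong (xor-same i) ih))
  a 0

⊕-isAbelianGroup : IsAbelianGroup _≡_ _⊕_ 0 (λ a → a)
⊕-isAbelianGroup = record
  { isGroup = record
    { isMonoid = record
      { isSemigroup = record
        { isMagma = record { isEquivalence = isEquivalence ; ∙-cong = cong₂ _⊕_ }
        ; assoc = ⊕-assoc }
      ; identity = ⊕-identityˡ , ⊕-identityʳ }
    ; inverse = ⊕-self , ⊕-self
    ; ⁻¹-cong = λ e → e }
  ; comm = ⊕-comm }

⊕-abelianGroup : AbelianGroup 0ℓ 0ℓ
⊕-abelianGroup = record { isAbelianGroup = ⊕-isAbelianGroup }

open import Algebra.Properties.AbelianGroup ⊕-abelianGroup using (inverseˡ-unique; inverseʳ-unique; //-rightDividesʳ; \\-leftDividesʳ; ∙-cancelʳ)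

⊕₃-bit : ∀ i j l a b c → (bit i + 2 * a) ⊕ (bit j + 2 * b) ⊕ (bit l + 2 * c) ≡ bit ((i xor j) xor l) + 2 * (a ⊕ b ⊕ c)
⊕₃-bit i j l a b c = trans (cong (_⊕ (bit l + 2 * c)) (⊕-bit i j a b)) (⊕-bit (i xor j) l (a ⊕ b) c)

⊕₃≡0⇒balanced : ∀ {x y z} → x ⊕ y ⊕ z ≡ 0 → x ≡ y ⊕ z × y ≡ x ⊕ z × z ≡ x ⊕ y
⊕₃≡0⇒balanced {x} {y} {z} e =
  inverseˡ-unique x (y ⊕ z) (trans (sym (⊕-assoc x y z)) e) ,
  inverseˡ-unique y (x ⊕ z) (trans (sym (⊕-assoc y x z)) (trans (cong (_⊕ z) (⊕-comm y x)) e)) ,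
  inverseʳ-unique (x ⊕ y) z e

⊕₃-self : ∀ y z → (y ⊕ z) ⊕ y ⊕ z ≡ 0
⊕₃-self y z = trans (⊕-assoc (y ⊕ z) y z) (⊕-self (y ⊕ z))

xor₃≡true⇒reducible : ∀ i j l → (i xor j) xor l ≡ true →
  bit (j xor l) < bit i ⊎ bit (i xor l) < bit j ⊎ bit (i xor j) < bit l
xor₃≡true⇒reducible false false false ()
xor₃≡true⇒reducible false false true  _  = inj₂ (inj₂ (s≤s z≤n))
xor₃≡true⇒reducible false true  false _  = inj₂ (inj₁ (s≤s z≤n))
xor₃≡true⇒reducible false true  true  ()
xor₃≡true⇒reducible true  false false _  = inj₁ (s≤s z≤n)
xor₃≡true⇒reducible true  false true  ()
xor₃≡true⇒reducible true  true  false ()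
xor₃≡true⇒reducible true  true  true  _  = inj₁ (s≤s z≤n)

⊕₃≢0⇒reducible : ∀ x y z → x ⊕ y ⊕ z ≢ 0 → y ⊕ z < x ⊎ x ⊕ z < y ⊎ x ⊕ y < z
⊕₃≢0⇒reducible = binary-ind₃ (λ x y z → x ⊕ y ⊕ z ≢ 0 → y ⊕ z < x ⊎ x ⊕ z < y ⊎ x ⊕ y < z) (λ ne → ⊥-elim (ne refl)) step
  where
  step : ∀ i j l {a b c} → (a ⊕ b ⊕ c ≢ 0 → b ⊕ c < a ⊎ a ⊕ c < b ⊎ a ⊕ b < c) →
         let x = bit i + 2 * a; y = bit j + 2 * b; z = bit l + 2 * c in
         x ⊕ y ⊕ z ≢ 0 → y ⊕ z < x ⊎ x ⊕ z < y ⊎ x ⊕ y < z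
  step i j l {a} {b} {c} ih ne with a ⊕ b ⊕ c ≟ 0
  ... | no  ne′ = ⊎-map (lift j l i b c a) (⊎-map (lift i l j a c b) (lift i j l a b c)) (ih ne′)
    where
    lift : ∀ p q r u v w → u ⊕ v < w → (bit p + 2 * u) ⊕ (bit q + 2 * v) < bit r + 2 * w
    lift p q r u v w lt = subst (_< _) (sym (⊕-bit p q u v)) (bit+2*-mono-< (p xor q) r lt)
  ... | yes e with (i xor j) xor l in parity | ⊕₃≡0⇒balanced {a} {b} {c} e
  ...   | false | _ = ⊥-elim (ne (trans (⊕₃-bit i j l a b c) (bit+2*-cong parity e)))
  ...   | true  | a≡ , b≡ , c≡ =
    ⊎-map (lift j l i b c a a≡) (⊎-map (lift i l j a c b b≡) (lift i j l a b c c≡)) (xor₃≡true⇒reducible i j l parity)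
    where
    lift : ∀ p q r u v w → w ≡ u ⊕ v → bit (p xor q) < bit r → (bit p + 2 * u) ⊕ (bit q + 2 * v) < bit r + 2 * w
    lift p q r u v w eq lt = subst (_< _) (sym (⊕-bit p q u v)) (bit+2*-<-≤ lt (≤-reflexive (sym eq)))

infixl 7 _∖_
_∖_ : ℕ → ℕ → ℕ
_∖_ = bitwise (λ p q → p ∧ not q)

∖-bit : ∀ i j a b → (bit i + 2 * a) ∖ (bit j + 2 * b) ≡ bit (i ∧ not j) + 2 * (a ∖ b)
∖-bit = bitwise-bit (λ p q → p ∧ not q) refl

⊕+≡+2*∖ : ∀ t o → t ⊕ o + o ≡ t + 2 * (o ∖ t)
⊕+≡+2*∖ = binary-ind₂ (λ t o → t ⊕ o + o ≡ t + 2 * (o ∖ t)) refl step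
  where
  digit : ∀ j l → bit (j xor l) + bit l ≡ bit j + 2 * bit (l ∧ not j)
  digit false false = refl
  digit false true  = refl
  digit true  false = refl
  digit true  true  = refl
  step : ∀ j l {t o} → t ⊕ o + o ≡ t + 2 * (o ∖ t) →
         (bit j + 2 * t) ⊕ (bit l + 2 * o) + (bit l + 2 * o) ≡ (bit j + 2 * t) + 2 * ((bit l + 2 * o) ∖ (bit j + 2 * t))
  step j l {t} {o} ih = begin
    (bit j + 2 * t) ⊕ (bit l + 2 * o) + (bit l + 2 * o)      ≡⟨ cong (_+ (bit l + 2 * o)) (⊕-bit j l t o) ⟩
    bit (j xor l) + 2 * (t ⊕ o) + (bit l + 2 * o)          ≡⟨ regroup (bit (j xor l)) (bit l) (t ⊕ o) o ⟩
    (bit (j xor l) + bit l) + 2 * (t ⊕ o + o)              ≡⟨ cong₂ (λ u v → u + 2 * v) (digit j l) ih ⟩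
    (bit j + 2 * bit (l ∧ not j)) + 2 * (t + 2 * (o ∖ t))  ≡⟨ regroup′ (bit j) (bit (l ∧ not j)) t (o ∖ t) ⟩
    (bit j + 2 * t) + 2 * (bit (l ∧ not j) + 2 * (o ∖ t))  ≡⟨ cong (λ r → (bit j + 2 * t) + 2 * r) (∖-bit l j o t) ⟨
    (bit j + 2 * t) + 2 * ((bit l + 2 * o) ∖ (bit j + 2 * t)) ∎
    where
    open ≡-Reasoning
    regroup : ∀ p q u v → p + 2 * u + (q + 2 * v) ≡ (p + q) + 2 * (u + v)
    regroup = solve-∀
    regroup′ : ∀ p q u v → (p + 2 * q) + 2 * (u + 2 * v) ≡ (p + 2 * u) + 2 * (q + 2 * v)
    regroup′ = solve-∀

odd≤even⇒< : ∀ d t w → (1 + 2 * d) * suc (2 * t) ≤ 2 * w → (1 + 2 * d) * suc (2 * t) < 2 * w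
odd≤even⇒< d t w le = ≤∧≢⇒< le (λ eq → 1+2*m≢2*n (d + t + 2 * (d * t)) w (trans (sym (odd*odd d t)) eq))
  where
  odd*odd : ∀ d t → (1 + 2 * d) * suc (2 * t) ≡ 1 + 2 * (d + t + 2 * (d * t))
  odd*odd = solve-∀

∖-descent : ∀ d y t o → let c = 1 + 2 * d in
            c * y ≤ o ∖ y → t < y → t ⊕ o < y ⊕ o → c * suc t < o ∖ t
∖-descent d = binary-ind₃ (λ y t o → c * y ≤ o ∖ y → t < y → t ⊕ o < y ⊕ o → c * suc t < o ∖ t) (λ _ ()) step
  where
  c : ℕ
  c = 1 + 2 * d
  step : ∀ i j l {y t o} → (c * y ≤ o ∖ y → t < y → t ⊕ o < y ⊕ o → c * suc t < o ∖ t) →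
         let y′ = bit i + 2 * y; t′ = bit j + 2 * t; o′ = bit l + 2 * o in
         c * y′ ≤ o′ ∖ y′ → t′ < y′ → t′ ⊕ o′ < y′ ⊕ o′ → c * suc t′ < o′ ∖ t′
  step i j l {y} {t} {o} ih feasible t<y t⊕o<y⊕o with t ≟ y
  ... | no t≢y = begin-strict
    c * suc (bit j + 2 * t)       ≤⟨ *-monoʳ-≤ c (bit+2*-mono-< j false ≤-refl) ⟩
    c * (2 * suc t)               ≡⟨ m*[2*n]≡2*[m*n] c (suc t) ⟩
    2 * (c * suc t)               <⟨ *-monoʳ-< 2 (ih feasible₁ t<y₁ t⊕o<y⊕o₁) ⟩
    2 * (o ∖ t)                   ≤⟨ m≤n+m _ (bit (l ∧ not j)) ⟩
    bit (l ∧ not j) + 2 * (o ∖ t) ≡⟨ ∖-bit l j o t ⟨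
    (bit l + 2 * o) ∖ (bit j + 2 * t) ∎
    where
    open ≤-Reasoning
    feasible₁ : c * y ≤ o ∖ y
    feasible₁ = *-bit+2*-cancel-≤ c i (l ∧ not i) (subst (c * (bit i + 2 * y) ≤_) (∖-bit l i o y) feasible)
    t<y₁ : t < y
    t<y₁ = ≤∧≢⇒< (bit+2*-cancel-≤ j i (<⇒≤ t<y)) t≢y
    t⊕o<y⊕o₁ : t ⊕ o < y ⊕ o
    t⊕o<y⊕o₁ = ≤∧≢⇒< (bit+2*-cancel-≤ (j xor l) (i xor l) (<⇒≤ (subst₂ _<_ (⊕-bit j l t o) (⊕-bit i l y o) t⊕o<y⊕o)))
                      (λ eq → t≢y (∙-cancelʳ o t y eq))
  ... | yes refl = top i j l feasible (+-cancelʳ-< (2 * t) (bit j) (bit i) t<y)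
    (+-cancelʳ-< (2 * (t ⊕ o)) (bit (j xor l)) (bit (i xor l)) (subst₂ _<_ (⊕-bit j l t o) (⊕-bit i l t o) t⊕o<y⊕o))
    where
    top : ∀ i j l → c * (bit i + 2 * t) ≤ (bit l + 2 * o) ∖ (bit i + 2 * t) → bit j < bit i → bit (j xor l) < bit (i xor l) →
          c * suc (bit j + 2 * t) < (bit l + 2 * o) ∖ (bit j + 2 * t)
    top true false false feasible _ _ = subst (c * suc (2 * t) <_) (sym (∖-bit false false o t))
      (odd≤even⇒< d t (o ∖ t) (subst (c * suc (2 * t) ≤_) (∖-bit false true o t) feasible))
    top true  true  _     _ (s≤s ()) _
    top true  false true  _ _ ()
    top false _     _     _ ()     _

∖-step : ∀ c t o → c * suc t < o ∖ t → c * suc t ≤ o ∖ suc t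
∖-step c = binary-ind₂ (λ t o → c * suc t < o ∖ t → c * suc t ≤ o ∖ suc t) (λ ()) step
  where
  open ≤-Reasoning
  step : ∀ j l {t o} → (c * suc t < o ∖ t → c * suc t ≤ o ∖ suc t) →
         c * suc (bit j + 2 * t) < (bit l + 2 * o) ∖ (bit j + 2 * t) →
         c * suc (bit j + 2 * t) ≤ (bit l + 2 * o) ∖ suc (bit j + 2 * t)
  step false l {t} {o} _ above = begin
    c * suc (2 * t)                      ≤⟨ ≤-pred (≤-trans above below-odd) ⟩
    2 * (o ∖ t)                          ≡⟨ cong (λ b → bit b + 2 * (o ∖ t)) (∧-zeroʳ l) ⟨
    bit (l ∧ false) + 2 * (o ∖ t)        ≡⟨ ∖-bit l true o t ⟨
    (bit l + 2 * o) ∖ (bit true + 2 * t) ∎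
    where
    below-odd : (bit l + 2 * o) ∖ (bit false + 2 * t) ≤ 1 + 2 * (o ∖ t)
    below-odd = ≤-trans (≤-reflexive (∖-bit l false o t)) (+-monoˡ-≤ _ (bit≤1 (l ∧ true)))
  step true l {t} {o} ih above = begin
    c * suc (suc (2 * t))               ≡⟨ cong (c *_) (*-suc 2 t) ⟨
    c * (2 * suc t)                     ≡⟨ m*[2*n]≡2*[m*n] c (suc t) ⟩
    2 * (c * suc t)                     ≤⟨ *-monoʳ-≤ 2 (ih above₁) ⟩
    2 * (o ∖ suc t)                     ≤⟨ m≤n+m _ (bit (l ∧ true)) ⟩
    bit (l ∧ true) + 2 * (o ∖ suc t)    ≡⟨ ∖-bit l false o (suc t) ⟨
    (bit l + 2 * o) ∖ (2 * suc t)       ≡⟨ cong ((bit l + 2 * o) ∖_) (*-suc 2 t) ⟩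
    (bit l + 2 * o) ∖ suc (suc (2 * t)) ∎
    where
    above₁ : c * suc t < o ∖ t
    above₁ = *-cancelˡ-< 2 _ _ (begin-strict
      2 * (c * suc t)                      ≡⟨ m*[2*n]≡2*[m*n] c (suc t) ⟨
      c * (2 * suc t)                      ≡⟨ cong (c *_) (*-suc 2 t) ⟩
      c * suc (suc (2 * t))                <⟨ above ⟩
      (bit l + 2 * o) ∖ (bit true + 2 * t) ≡⟨ ∖-bit l true o t ⟩
      bit (l ∧ false) + 2 * (o ∖ t)        ≡⟨ cong (λ b → bit b + 2 * (o ∖ t)) (∧-zeroʳ l) ⟩
      2 * (o ∖ t)                          ∎)

crossing : (f g : ℕ → ℕ) → (∀ t → g (suc t) < f t → g (suc t) ≤ f (suc t)) →
           ∀ {a b} → a ≤ b → g a ≤ f a → f b < g b →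
           ∃[ t ] a ≤ t × t < b × g t ≤ f t × f t ≤ g (suc t)
crossing f g no-jump {a} {b} a≤b ga≤fa fb<gb =
  let t , a≤t , t<b , gt≤ft , ft≤gt+1 = go (b ∸ a) a ga≤fa (subst (λ n → f n < g n) (sym (m∸n+n≡m a≤b)) fb<gb)
  in  t , a≤t , subst (t <_) (m∸n+n≡m a≤b) t<b , gt≤ft , ft≤gt+1
  where
  go : ∀ n a → g a ≤ f a → f (n + a) < g (n + a) → ∃[ t ] a ≤ t × t < n + a × g t ≤ f t × f t ≤ g (suc t)
  go zero    a ga≤fa fb<gb = contradiction ga≤fa (<⇒≱ fb<gb)
  go (suc n) a ga≤fa fb<gb with f a ≤? g (suc a)
  ... | yes fa≤ga+1 = a , ≤-refl , s≤s (m≤n+m a n) , ga≤fa , fa≤ga+1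
  ... | no  fa≰ga+1 with go n (suc a) (no-jump a (≰⇒> fa≰ga+1)) (subst (λ n → f n < g n) (sym (+-suc n a)) fb<gb)
  ...   | t , a<t , t<b , gt≤ft , ft≤gt+1 = t , <⇒≤ a<t , subst (t <_) (+-suc n a) t<b , gt≤ft , ft≤gt+1

record Run (c x y z : ℕ) : Set where
  field
    lower          : ℕ
    lower≤y        : lower ≤ y
    lower-feasible : c * lower ≤ z ∖ lower
    admissible     : ∀ t → lower ≤ t → t ≤ y → t ⊕ z < x

Run-double : ∀ {c x y z} i j l → Run c x y z → Run c (bit i + 2 * x) (bit j + 2 * y) (bit l + 2 * z)
Run-double {c} {x} {y} {z} i j l R = record
  { lower          = 2 * lower
  ; lower≤y        = ≤-trans (*-monoʳ-≤ 2 lower≤y) (m≤n+m _ (bit j))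
  ; lower-feasible = begin
      c * (2 * lower)                  ≡⟨ m*[2*n]≡2*[m*n] c lower ⟩
      2 * (c * lower)                  ≤⟨ *-monoʳ-≤ 2 lower-feasible ⟩
      2 * (z ∖ lower)                  ≤⟨ m≤n+m _ (bit (l ∧ true)) ⟩
      bit (l ∧ true) + 2 * (z ∖ lower) ≡⟨ ∖-bit l false z lower ⟨
      (bit l + 2 * z) ∖ (2 * lower)    ∎
  ; admissible     = admissible′
  }
  where
  open ≤-Reasoning
  open Run R
  admissible′ : ∀ t → 2 * lower ≤ t → t ≤ bit j + 2 * y → t ⊕ (bit l + 2 * z) < bit i + 2 * x
  admissible′ t lower≤t t≤y with binary-split t
  ... | e , t₁ , refl = subst (_< _) (sym (⊕-bit e l t₁ z))
    (bit+2*-mono-< (e xor l) i (admissible t₁ (bit+2*-cancel-≤ false e lower≤t) (bit+2*-cancel-≤ e j t≤y)))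

run-top : ∀ c i j l y z → let x′ = bit i + 2 * (y ⊕ z); y′ = bit j + 2 * y; z′ = bit l + 2 * z in
          y′ ⊕ z′ < x′ → (1 + 2 * c) * y′ ≤ x′ + z′ + 2 → bit (j xor l) < bit i → bit j ≤ bit (i xor l) →
          Run c x′ y′ z′
run-top c true false false y z y⊕z<x k*y≤ _ _ = record
  { lower          = 2 * y
  ; lower≤y        = ≤-refl
  ; lower-feasible = subst₂ _≤_ (sym (m*[2*n]≡2*[m*n] c y)) (sym (∖-bit false false z y)) (*-monoʳ-≤ 2 feasible)
  ; admissible     = λ t y≤t t≤y → subst (λ u → u ⊕ (2 * z) < 1 + 2 * (y ⊕ z)) (≤-antisym y≤t t≤y) y⊕z<x
  }
  where
  open ≤-Reasoning
  feasible : c * y ≤ z ∖ y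
  feasible = bit+2*-cancel-≤ false true (bit+2*-cancel-≤ false true (+-cancelˡ-≤ (2 * y) _ _ (begin
    2 * y + 2 * (2 * (c * y))           ≡⟨ e₁ c y ⟩
    (1 + 2 * c) * (2 * y)               ≤⟨ k*y≤ ⟩
    1 + 2 * (y ⊕ z) + 2 * z + 2         ≡⟨ e₂ (y ⊕ z) z ⟩
    3 + 2 * (y ⊕ z + z)                 ≡⟨ cong (λ r → 3 + 2 * r) (⊕+≡+2*∖ y z) ⟩
    3 + 2 * (y + 2 * (z ∖ y))           ≡⟨ e₃ y (z ∖ y) ⟩
    2 * y + (1 + 2 * (1 + 2 * (z ∖ y))) ∎)))
    where
    e₁ : ∀ c y → 2 * y + 2 * (2 * (c * y)) ≡ (1 + 2 * c) * (2 * y)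
    e₁ = solve-∀
    e₂ : ∀ u z → 1 + 2 * u + 2 * z + 2 ≡ 3 + 2 * (u + z)
    e₂ = solve-∀
    e₃ : ∀ y w → 3 + 2 * (y + 2 * w) ≡ 2 * y + (1 + 2 * (1 + 2 * w))
    e₃ = solve-∀
run-top c false _     _     _ _ _ _ ()       _
run-top c true  false true  _ _ _ _ (s≤s ()) _
run-top c true  true  false _ _ _ _ (s≤s ()) _
run-top c true  true  true  _ _ _ _ _        ()

-- The slack 2 is what survives halving: x + z + 2 ≤ 2 (x₁ + z₁ + 2) for the halves x₁, z₁.
run : ∀ c x y z → y ⊕ z < x → y ≤ x ⊕ z → (1 + 2 * c) * y ≤ x + z + 2 → Run c x y z
run c = binary-ind₃ (λ x y z → y ⊕ z < x → y ≤ x ⊕ z → k * y ≤ x + z + 2 → Run c x y z) (λ ()) step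
  where
  k : ℕ
  k = 1 + 2 * c
  step : ∀ i j l {x y z} → (y ⊕ z < x → y ≤ x ⊕ z → k * y ≤ x + z + 2 → Run c x y z) →
         let x′ = bit i + 2 * x; y′ = bit j + 2 * y; z′ = bit l + 2 * z in
         y′ ⊕ z′ < x′ → y′ ≤ x′ ⊕ z′ → k * y′ ≤ x′ + z′ + 2 → Run c x′ y′ z′
  step i j l {x} {y} {z} ih y⊕z<x y≤x⊕z k*y≤ with x ≟ y ⊕ z
  ... | no x≢y⊕z = Run-double i j l (ih y⊕z<x₁ y≤x⊕z₁ k*y≤₁)
    where
    y⊕z<x₁ : y ⊕ z < x
    y⊕z<x₁ = ≤∧≢⇒< (bit+2*-cancel-≤ (j xor l) i (<⇒≤ (subst (_< _) (⊕-bit j l y z) y⊕z<x))) (λ eq → x≢y⊕z (sym eq))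
    y≤x⊕z₁ : y ≤ x ⊕ z
    y≤x⊕z₁ = bit+2*-cancel-≤ j (i xor l) (subst (_ ≤_) (⊕-bit i l x z) y≤x⊕z)
    k*y≤₁ : k * y ≤ x + z + 2
    k*y≤₁ = *-bit+2*-cancel-≤ k j false (begin
      k * (bit j + 2 * y)                 ≤⟨ k*y≤ ⟩
      bit i + 2 * x + (bit l + 2 * z) + 2 ≤⟨ +-monoˡ-≤ 2 (+-mono-≤ (+-monoˡ-≤ _ (bit≤1 i)) (+-monoˡ-≤ _ (bit≤1 l))) ⟩
      1 + 2 * x + (1 + 2 * z) + 2         ≡⟨ regroup x z ⟩
      2 * (x + z + 2)                     ∎)
      where
      open ≤-Reasoning
      regroup : ∀ x z → 1 + 2 * x + (1 + 2 * z) + 2 ≡ 2 * (x + z + 2)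
      regroup = solve-∀
  ... | yes refl = run-top c i j l y z y⊕z<x k*y≤
    (+-cancelʳ-< (2 * (y ⊕ z)) (bit (j xor l)) (bit i) (subst (_< _) (⊕-bit j l y z) y⊕z<x))
    (+-cancelʳ-≤ (2 * y) (bit j) (bit (i xor l))
      (subst (_ ≤_) (trans (⊕-bit i l (y ⊕ z) z) (cong (λ r → bit (i xor l) + 2 * r) (//-rightDividesʳ z y))) y≤x⊕z))

exact-point : ∀ c x y z → y ⊕ z < x → y ≤ x ⊕ z → (1 + 2 * c) * y ≤ x + z → z ∖ y < c * y →
              ∃[ t ] t < y × t ⊕ z < x × c * t ≤ z ∖ t × z ∖ t ≤ c * suc t
exact-point c x y z y⊕z<x y≤x⊕z k*y≤x+z infeasible =
  let t , lower≤t , t<y , feasible , exact =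
        crossing (z ∖_) (c *_) (λ t → ∖-step c t z) lower≤y lower-feasible infeasible
  in  t , t<y , admissible t lower≤t (<⇒≤ t<y) , feasible , exact
  where open Run (run c x y z y⊕z<x y≤x⊕z (≤-trans k*y≤x+z (m≤m+n (x + z) 2)))

m≤n/o⇒m*o≤n : ∀ {m n o} .{{_ : NonZero o}} → m ≤ n / o → m * o ≤ n
m≤n/o⇒m*o≤n {m} {n} {o} le = ≤-trans (*-monoˡ-≤ o le) (m/n*n≤m n o)

m*o≤n⇒m≤n/o : ∀ {m n o} .{{_ : NonZero o}} → m * o ≤ n → m ≤ n / o
m*o≤n⇒m≤n/o {m} {n} {o} le = subst (_≤ n / o) (m*n/n≡m m o) (/-monoˡ-≤ o le)

module Game (m : ℕ) where

  c k : ℕ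
  c = 1 + 2 * m
  k = suc (suc (suc (4 * m)))

  t*k≡t+2*[c*t] : ∀ t → t * k ≡ t + 2 * (c * t)
  t*k≡t+2*[c*t] t = e m t
    where
    e : ∀ m t → t * suc (suc (suc (4 * m))) ≡ t + 2 * ((1 + 2 * m) * t)
    e = solve-∀

  feasible⇒≤fk : ∀ t o → c * t ≤ o ∖ t → t ≤ fk m (t ⊕ o) o
  feasible⇒≤fk t o feasible = m*o≤n⇒m≤n/o (begin
    t * k                ≡⟨ t*k≡t+2*[c*t] t ⟩
    t + 2 * (c * t)      ≤⟨ +-monoʳ-≤ t (*-monoʳ-≤ 2 feasible) ⟩
    t + 2 * (o ∖ t)      ≡⟨ ⊕+≡+2*∖ t o ⟨
    t ⊕ o + o            ∎)
    where open ≤-Reasoning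

  ≤fk⇒feasible : ∀ t o → t ≤ fk m (t ⊕ o) o → c * t ≤ o ∖ t
  ≤fk⇒feasible t o le = *-cancelˡ-≤ 2 (+-cancelˡ-≤ t _ _ (begin
    t + 2 * (c * t)      ≡⟨ t*k≡t+2*[c*t] t ⟨
    t * k                ≤⟨ m≤n/o⇒m*o≤n le ⟩
    t ⊕ o + o            ≡⟨ ⊕+≡+2*∖ t o ⟩
    t + 2 * (o ∖ t)      ∎))
    where open ≤-Reasoning

  above⇒<fk : ∀ t o → c * suc t < o ∖ t → t < fk m (t ⊕ o) o
  above⇒<fk t o above = m*o≤n⇒m≤n/o (begin
    suc t * k                ≡⟨ t*k≡t+2*[c*t] (suc t) ⟩
    suc t + 2 * (c * suc t)  ≡⟨ +-suc t _ ⟨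
    t + suc (2 * (c * suc t)) <⟨ +-monoʳ-< t (bit+2*-mono-< true false above) ⟩
    t + 2 * (o ∖ t)          ≡⟨ ⊕+≡+2*∖ t o ⟨
    t ⊕ o + o                ∎)
    where open ≤-Reasoning

  exact⇒fk≡ : ∀ t o → c * t ≤ o ∖ t → o ∖ t ≤ c * suc t → fk m (t ⊕ o) o ≡ t
  exact⇒fk≡ t o feasible exact = ≤-antisym (≤-pred (m<n*o⇒m/o<n (begin-strict
    t ⊕ o + o                 ≡⟨ ⊕+≡+2*∖ t o ⟩
    t + 2 * (o ∖ t)           ≤⟨ +-monoʳ-≤ t (*-monoʳ-≤ 2 exact) ⟩
    t + 2 * (c * suc t)       <⟨ +-monoʳ-< t (n<1+n _) ⟩
    t + suc (2 * (c * suc t)) ≡⟨ +-suc t _ ⟩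
    suc t + 2 * (c * suc t)   ≡⟨ t*k≡t+2*[c*t] (suc t) ⟨
    suc t * k                 ∎)))
    (feasible⇒≤fk t o feasible)
    where open ≤-Reasoning

  nim : Pos → ℕ
  nim (x , y , z) = x ⊕ y ⊕ z

  legal⇒bound : ∀ x y z → Legal m (x , y , z) → (1 + 2 * c) * y ≤ x + z
  legal⇒bound x y z legal = subst (_≤ x + z) (trans (*-comm y k) (cong (_* y) (k≡ m))) (m≤n/o⇒m*o≤n legal)
    where
    k≡ : ∀ m → suc (suc (suc (4 * m))) ≡ 1 + 2 * (1 + 2 * m)
    k≡ = solve-∀

  x-move-unbalances : ∀ {x y z} u → Legal m (x , y , z) → x ⊕ y ⊕ z ≡ 0 → u < x → u ⊕ (fk m u z ⊓ y) ⊕ z ≢ 0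
  x-move-unbalances {x} {y} {z} u legal balanced u<x balanced′ = cap-cases (⊓-sel (fk m u z) y)
    where
    t : ℕ
    t = fk m u z ⊓ y
    x≡y⊕z : x ≡ y ⊕ z
    x≡y⊕z = proj₁ (⊕₃≡0⇒balanced balanced)
    u≡t⊕z : u ≡ t ⊕ z
    u≡t⊕z = proj₁ (⊕₃≡0⇒balanced balanced′)
    t≢y : t ≢ y
    t≢y t≡y = <-irrefl (trans u≡t⊕z (trans (cong (_⊕ z) t≡y) (sym x≡y⊕z))) u<x
    feasible : c * y ≤ z ∖ y
    feasible = ≤fk⇒feasible y z (subst (λ x → y ≤ fk m x z) x≡y⊕z legal)
    cap-cases : t ≡ fk m u z ⊎ t ≡ y → ⊥
    cap-cases (inj₂ t≡y) = t≢y t≡y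
    cap-cases (inj₁ t≡f) = <-irrefl t≡f (subst (λ u → t < fk m u z) (sym u≡t⊕z)
      (above⇒<fk t z (∖-descent m y t z feasible (≤∧≢⇒< (m⊓n≤n _ y) t≢y) (subst₂ _<_ u≡t⊕z x≡y⊕z u<x))))

  Balancing : Pos → Set
  Balancing p = ∃[ q ] Move m p q × nim q ≡ 0

  x-move-balances : ∀ {x y z} → Legal m (x , y , z) → y ≤ x ⊕ z → y ⊕ z < x → Balancing (x , y , z)
  x-move-balances {x} {y} {z} legal y≤x⊕z y⊕z<x with y ≤? fk m (y ⊕ z) z
  ... | yes y≤f = (y ⊕ z , fk m (y ⊕ z) z ⊓ y , z) , moveX (y ⊕ z) y⊕z<x ,
                  subst (λ s → (y ⊕ z) ⊕ s ⊕ z ≡ 0) (sym (m≥n⇒m⊓n≡n y≤f)) (⊕₃-self y z)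
  ... | no  y≰f =
    let t , t<y , t⊕z<x , feasible , exact =
          exact-point c x y z y⊕z<x y≤x⊕z (legal⇒bound x y z legal) (≰⇒> (λ feasible → y≰f (feasible⇒≤fk y z feasible)))
        cap : fk m (t ⊕ z) z ⊓ y ≡ t
        cap = trans (cong (_⊓ y) (exact⇒fk≡ t z feasible exact)) (m≤n⇒m⊓n≡m (<⇒≤ t<y))
    in  (t ⊕ z , fk m (t ⊕ z) z ⊓ y , z) , moveX (t ⊕ z) t⊕z<x ,
        subst (λ s → (t ⊕ z) ⊕ s ⊕ z ≡ 0) (sym cap) (⊕₃-self t z)

  fk-comm : ∀ x z → fk m x z ≡ fk m z x
  fk-comm x z = cong (_/ k) (+-comm x z)

  cap-comm : ∀ x y w → y ⊓ fk m x w ≡ fk m w x ⊓ y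
  cap-comm x y w = trans (⊓-comm y (fk m x w)) (cong (_⊓ y) (fk-comm x w))

  swap : Pos → Pos
  swap (x , y , z) = z , y , x

  nim-swap : ∀ p → nim (swap p) ≡ nim p
  nim-swap (x , y , z) = trans (⊕-comm (z ⊕ y) x) (trans (cong (x ⊕_) (⊕-comm z y)) (sym (⊕-assoc x y z)))

  Legal-swap : ∀ {p} → Legal m p → Legal m (swap p)
  Legal-swap {x , y , z} = subst (y ≤_) (fk-comm x z)

  Move-swap : ∀ {p q} → Move m p q → Move m (swap p) (swap q)
  Move-swap {x , y , z} (moveX u u<x) = subst (λ s → Move m (z , y , x) (z , s , u)) (cap-comm z y u) (moveZ u u<x)
  Move-swap             (moveY v v<y) = moveY v v<y
  Move-swap {x , y , z} (moveZ w w<z) = subst (λ s → Move m (z , y , x) (w , s , x)) (sym (cap-comm x y w)) (moveX w w<z)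

  zero-moves-unbalance : ∀ {p q} → Legal m p → nim p ≡ 0 → Move m p q → nim q ≢ 0
  zero-moves-unbalance legal balanced (moveX u u<x) = x-move-unbalances u legal balanced u<x
  zero-moves-unbalance {x , y , z} legal balanced (moveY v v<y) balanced′ =
    <-irrefl (trans (proj₁ (proj₂ (⊕₃≡0⇒balanced {x} {v} balanced′))) (sym (proj₁ (proj₂ (⊕₃≡0⇒balanced {x} {y} balanced))))) v<y
  zero-moves-unbalance {x , y , z} legal balanced (moveZ w w<z) balanced′ =
    x-move-unbalances w (Legal-swap {x , y , z} legal) (trans (nim-swap (x , y , z)) balanced) w<z
      (trans (nim-swap (x , fk m w x ⊓ y , w)) (subst (λ s → x ⊕ s ⊕ w ≡ 0) (cap-comm x y w) balanced′))

  nonzero-balances : ∀ {p} → Legal m p → nim p ≢ 0 → Balancing p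
  nonzero-balances {x , y , z} legal unbalanced with x ⊕ z <? y
  ... | yes x⊕z<y = (x , x ⊕ z , z) , moveY (x ⊕ z) x⊕z<y ,
                    trans (cong (_⊕ z) (\\-leftDividesʳ x z)) (⊕-self z)
  ... | no  x⊕z≮y with ⊕₃≢0⇒reducible x y z unbalanced
  ...   | inj₁ y⊕z<x        = x-move-balances legal (≮⇒≥ x⊕z≮y) y⊕z<x
  ...   | inj₂ (inj₁ x⊕z<y) = ⊥-elim (x⊕z≮y x⊕z<y)
  ...   | inj₂ (inj₂ x⊕y<z) =
    let q , move , balanced = x-move-balances {z} {y} {x} (Legal-swap {x , y , z} legal)
                                (subst (y ≤_) (⊕-comm x z) (≮⇒≥ x⊕z≮y)) (subst (_< z) (⊕-comm x y) x⊕y<z)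
    in  swap q , Move-swap move , trans (nim-swap q) balanced

  size : Pos → ℕ
  size (x , y , z) = x + y + z

  Move-legal : ∀ {p q} → Legal m p → Move m p q → Legal m q
  Move-legal _     (moveX u _)   = m⊓n≤m _ _
  Move-legal legal (moveY v v<y) = ≤-trans (<⇒≤ v<y) legal
  Move-legal _     (moveZ w _)   = m⊓n≤n _ _

  Move-size : ∀ {p q} → Move m p q → size q < size p
  Move-size {x , y , z} (moveX u u<x) = +-monoˡ-< z (+-mono-<-≤ u<x (m⊓n≤n _ y))
  Move-size {x , y , z} (moveY v v<y) = +-monoˡ-< z (+-monoʳ-< x v<y)
  Move-size {x , y , z} (moveZ w w<z) = +-mono-≤-< (+-monoʳ-≤ x (m⊓n≤m y _)) w<z

  classify : ∀ p → Legal m p → Acc _<_ (size p) → (nim p ≡ 0 → IsP m p) × (nim p ≢ 0 → IsN m p)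
  classify p legal (acc rs) =
    (λ balanced → isP (λ q move → proj₂ (next q move) (zero-moves-unbalance legal balanced move))) ,
    (λ unbalanced → let q , move , balanced = nonzero-balances legal unbalanced in isN q move (proj₁ (next q move) balanced))
    where
    next : ∀ q → Move m p q → (nim q ≡ 0 → IsP m q) × (nim q ≢ 0 → IsN m q)
    next q move = classify q (Move-legal legal move) (rs (Move-size move))

IsP-IsN-exclusive : ∀ {m p} → IsP m p → IsN m p → ⊥
IsP-IsN-exclusive (isP all-N) (isN q move q-P) = IsP-IsN-exclusive q-P (all-N q move)

theorem2p11 : (m x y z : ℕ) → Legal m (x , y , z) →
    IsP m (x , y , z) ⇔ (x ⊕ y ⊕ z ≡ 0)
theorem2p11 m x y z legal = mk⇔ to (proj₁ classified)
  where
  open Game m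
  classified : (x ⊕ y ⊕ z ≡ 0 → IsP m (x , y , z)) × (x ⊕ y ⊕ z ≢ 0 → IsN m (x , y , z))
  classified = classify (x , y , z) legal (<-wellFounded _)
  to : IsP m (x , y , z) → x ⊕ y ⊕ z ≡ 0
  to P with x ⊕ y ⊕ z ≟ 0
  ... | yes balanced = balanced
  ... | no unbalanced = ⊥-elim (IsP-IsN-exclusive P (proj₂ classified unbalanced))
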